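{- Let $s$ be a string with Lyndon runs $F_1,\dots,F_m$ and let $\mathrm{dom}_{d+p-1}(F_i),\dots,\mathrm{dom}_d(F_{i+p-1})$ ($p\ge2$) be a $p$-group. Then the substring of $s$ associated with the $p$-group is the concatenation, in reverse order, of the substrings associated with the tandem domains belonging to the $p$-group; that is, it equals $\alpha_{p-2}\alpha_{p-3}\cdots\alpha_0$ where $\alpha_t$ is the substring (occurrence) associated with the tandem domain $\mathrm{dom}_{d+p-1-t}(F_{i+t})$, $\mathrm{dom}_{d+p-2-t}(F_{i+t+1})$.
   Context: Let $s=f_1^{e_1}\cdots f_m^{e_m}$ be the Lyndon factorization of $s$ (each $f_i$ a Lyndon word, i.e. a nonempty string strictly lexicographically smaller than all its nonempty proper suffixes; $e_i\ge1$; $f_i\succ f_{i+1}$) and $F_i=f_i^{e_i}$ the Lyndon runs, viewed as consecutive substrings of $s$. For $d\ge1$, $1\le i\le m-d+1$, the leftmost occurrence of $F_i\cdots F_{i+d-1}$ in $s$ begins at the first position of some run $F_j$, $j\le i$; $\mathrm{dom}_d(F_i)=F_j\cdots F_{i-1}$ (empty if $j=i$) and $\mathrm{extdom}_d(F_i)=F_j\cdots F_{i+d-1}$, as substrings (positions) of $s$. The pair $\mathrm{dom}_{d+1}(F_i)$, $\mathrm{dom}_d(F_{i+1})$ is a tandem domain if $\mathrm{extdom}_{d+1}(F_i)=\mathrm{extdom}_d(F_{i+1})$; then $F_i=F_{i+1}\cdots F_{i+d}x$ for some $x$, the leftmost occurrence of $F_i\cdots F_{i+d}$ reads $F_{i+1}\cdots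 F_{i+d}\,x\,F_{i+1}\cdots F_{i+d}$, and the occurrence of $xF_{i+1}\cdots F_{i+d}$ forming its suffix is the substring associated with the tandem domain. For $d\ge1$, $p\ge2$, $1\le i\le m-d-p+2$, the domains $\mathrm{dom}_{d+p-1}(F_i),\dots,\mathrm{dom}_d(F_{i+p-1})$ form a $p$-group if $\mathrm{extdom}_{d+p-1}(F_i)=\mathrm{extdom}_{d+p-2}(F_{i+1})=\cdots=\mathrm{extdom}_d(F_{i+p-1})$; its consecutive pairs are the tandem domains belonging to it. For a $p$-group, $F_{i+p-1}\cdots F_{i+p+d-2}$ is a prefix of $F_i$, so the leftmost occurrence of $F_i\cdots F_{i+p+d-2}$ in $s$ can be written as $F_{i+p-1}\cdots F_{i+p+d-2}\,x\,F_{i+1}\cdots F_{i+p+d-2}$; the occurrence of $xF_{i+1}\cdots F_{i+p+d-2}$ forming its suffix is the substring associated with the $p$-group. -}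

module Defs where

open import Data.Nat using (ℕ; zero; suc; _+_; _<_; _≤_)
open import Data.List using (List; []; _∷_; _++_; length; take; drop; concat; replicate; map)
open import Data.List.Relation.Unary.All using (All)
open import Data.List.Relation.Unary.Linked using (Linked)
open import Data.List.Relation.Binary.Lex.Strict using (Lex-<)
open import Data.Product using (Σ; ∃; ∃-syntax; _×_; _,_; proj₁; proj₂)
open import Relation.Binary.PropositionalEquality using (_≡_)
open import Relation.Nullary using (¬_)
open import Function using (_∘_)

module _ {A : Set} (_<ₐ_ : A → A → Set) where

  _≺_ : List A → List A → Set
  _≺_ = Lex-< _≡_ _<ₐ_

  IsLyndon : List A → Set
  IsLyndon w = (1 ≤ length w) × (∀ k → 1 ≤ k → k < length w → w ≺ drop k w)

  pow : List A → ℕ → List A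
  pow f e = concat (replicate e f)

  IsLyndonFactorization : List (List A × ℕ) → List A → Set
  IsLyndonFactorization fs s =
    All (λ fe → IsLyndon (proj₁ fe) × (1 ≤ proj₂ fe)) fs
    × Linked (λ fe ge → proj₁ ge ≺ proj₁ fe) fs
    × concat (map (λ fe → pow (proj₁ fe) (proj₂ fe)) fs) ≡ s

-- Lyndon runs Fᵢ = fᵢ^{eᵢ} (0-indexed list)
runs : {A : Set} → List (List A × ℕ) → List (List A)
runs fs = map (λ fe → concat (replicate (proj₂ fe) (proj₁ fe))) fs

-- Intervals [a , b) of positions of s (half-open), i.e. occurrences.
Interval : Set
Interval = ℕ × ℕ

module _ {A : Set} where

  OccursAt : List A → List A → ℕ → Set
  OccursAt w s k = (k + length w ≤ length s) × (take (length w) (drop k s) ≡ w)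

  LeftmostOcc : List A → List A → ℕ → Set
  LeftmostOcc w s k = OccursAt w s k × (∀ k' → k' < k → ¬ OccursAt w s k')

  start : List (List A) → ℕ → ℕ
  start F i = length (concat (take i F))

  block : List (List A) → ℕ → ℕ → List A
  block F i d = concat (take d (drop i F))

  -- extdom_d(Fᵢ) = F_j ⋯ F_{i+d-1} as an interval of positions, where the
  -- leftmost occurrence of Fᵢ⋯F_{i+d-1} begins at the first position of F_j.
  ExtDom : List A → List (List A) → ℕ → ℕ → Interval → Set
  ExtDom s F d i I =
    ∃[ j ] (j ≤ i × LeftmostOcc (block F i d) s (start F j)
            × proj₁ I ≡ start F j × proj₂ I ≡ start F (i + d))

  -- dom_{d+p-1}(Fᵢ), …, dom_d(F_{i+p-1}) form a p-group: all the extended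
  -- domains extdom_{d+p-1-t}(F_{i+t}), t = 0,…,p-1, are equal.
  PGroup : List A → List (List A) → ℕ → ℕ → ℕ → Set
  PGroup s F i d p =
    ∃[ I ] (∀ t → t < p → ExtDom s F (d + (p Data.Nat.∸ 1 Data.Nat.∸ t)) (i + t) I)

  -- substring (occurrence) associated with the p-group
  -- dom_{d+p-1}(Fᵢ),…,dom_d(F_{i+p-1}): the leftmost occurrence (at L) of
  -- Fᵢ⋯F_{i+p+d-2} reads F_{i+p-1}⋯F_{i+p+d-2} x F_{i+1}⋯F_{i+p+d-2};
  -- the associated occurrence is its suffix x F_{i+1}⋯F_{i+p+d-2}.
  PGroupSub : List A → List (List A) → ℕ → ℕ → ℕ → Interval → Set
  PGroupSub s F i d p I =
    ∃[ L ] ∃[ x ] (LeftmostOcc (block F i (p + d Data.Nat.∸ 1)) s L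
      × block F i (p + d Data.Nat.∸ 1)
          ≡ block F (i + (p Data.Nat.∸ 1)) d ++ x ++ block F (i + 1) (p + d Data.Nat.∸ 2)
      × proj₁ I ≡ L + length (block F (i + (p Data.Nat.∸ 1)) d)
      × proj₂ I ≡ L + length (block F i (p + d Data.Nat.∸ 1)))

  -- substring (occurrence) associated with the tandem domain
  -- dom_{d+1}(Fᵢ), dom_d(F_{i+1}): the leftmost occurrence (at L) of
  -- Fᵢ⋯F_{i+d} reads F_{i+1}⋯F_{i+d} x F_{i+1}⋯F_{i+d}; the associated
  -- occurrence is its suffix x F_{i+1}⋯F_{i+d}.
  TandemSub : List A → List (List A) → ℕ → ℕ → Interval → Set
  TandemSub s F i d I =
    ∃[ L ] ∃[ x ] (LeftmostOcc (block F i (suc d)) s L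
      × block F i (suc d) ≡ block F (i + 1) d ++ x ++ block F (i + 1) d
      × proj₁ I ≡ L + length (block F (i + 1) d)
      × proj₂ I ≡ L + length (block F i (suc d)))

-- I is the concatenation (as adjacent occurrences) of α (n-1), …, α 1, α 0
-- in this order (reverse order of indices).
RevConcat : Interval → (ℕ → Interval) → ℕ → Set
RevConcat I α zero = proj₁ I ≡ proj₂ I
RevConcat I α (suc n) =
  proj₂ (α 0) ≡ proj₂ I × RevConcat (proj₁ I , proj₁ (α 0)) (α ∘ suc) n

-- All extended domains of a p-group are one interval, so the blocks
-- Bₜ = F_{i+t} ⋯ F_{i+p+d-2} (t < p) all have their leftmost occurrence at the
-- same position S.  Hence the substring associated with the tandem domain t is
-- [S + |B_{t+1}|, S + |Bₜ|) and the one associated with the p-group is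
-- [S + |B_{p-1}|, S + |B₀|); these intervals telescope.
--
-- The words x exist because a block of later runs that starts where Fₐ = fᵉ
-- starts must be a prefix of Fₐ: otherwise the Lyndon word f would be a prefix
-- of a concatenation of words smaller than f, impossible since every nonempty
-- suffix of f is at least f.

module Submission where

open import Defs hiding (_≺_)
open import Data.Nat using (ℕ; zero; suc; _+_; _∸_; _<_; _≤_; z≤n; s≤s)
open import Data.Nat.Properties
  using (<-cmp; n<1+n; m≤n⇒m≤1+n; ≤-pred; m<m+n; +-suc; +-comm; +-assoc; +-identityʳ;
         n∸n≡0; +-∸-assoc)
open import Data.List using (List; []; _∷_; _++_; length; take; drop; concat; replicate)
open import Data.List.Properties
  using (∷-injective; ++-assoc; ++-identityʳ; ++-conicalˡ; length-++; concat-++; take++drop≡id;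
         take-map; drop-map; take-[]; drop-[])
open import Data.List.Relation.Unary.All using (All; []; _∷_)
open import Data.List.Relation.Unary.All.Properties using (++⁺; replicate⁺; take⁺; drop⁺)
open import Data.List.Relation.Unary.AllPairs using (AllPairs; _∷_)
open import Data.List.Relation.Unary.Linked using (Linked)
open import Data.List.Relation.Unary.Linked.Properties using (Linked⇒AllPairs)
open import Data.List.Relation.Binary.Lex.Strict using (Lex-<; halt; next; <-isStrictPartialOrder)
open import Data.List.Relation.Binary.Pointwise using (≡⇒Pointwise-≡)
open import Data.Product using (Σ; ∃; ∃₂; _×_; _,_; proj₁; proj₂)
open import Data.Sum using (_⊎_; inj₁; inj₂) renaming (map to ⊎-map)
open import Data.Empty using (⊥-elim)
open import Function using (_∘_)
open import Relation.Binary.PropositionalEquality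
  using (_≡_; _≢_; refl; sym; trans; cong; cong₂; subst; module ≡-Reasoning)
open import Relation.Binary.Structures using (IsStrictTotalOrder; IsStrictPartialOrder)
open import Relation.Binary.Definitions using (tri<; tri≈; tri>)
open import Relation.Nullary using (¬_)

module _ {A : Set} where

  ++-prefix-cases : ∀ (a b c e : List A) → a ++ b ≡ c ++ e →
    (∃ λ m → c ≡ a ++ m) ⊎ (∃₂ λ y m → a ≡ c ++ y ∷ m × y ∷ m ++ b ≡ e)
  ++-prefix-cases [] b c e eq = inj₁ (c , refl)
  ++-prefix-cases (y ∷ a) b [] e eq = inj₂ (y , a , refl , eq)
  ++-prefix-cases (y ∷ a) b (z ∷ c) e eq with ∷-injective eq
  ... | refl , eq′ with ++-prefix-cases a b c e eq′
  ...   | inj₁ (m , c≡am) = inj₁ (m , cong (y ∷_) c≡am)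
  ...   | inj₂ (y′ , m , a≡cym , rest) = inj₂ (y′ , m , cong (y ∷_) a≡cym , rest)

  drop-length-++ : ∀ (u v : List A) → drop (length u) (u ++ v) ≡ v
  drop-length-++ [] v = refl
  drop-length-++ (x ∷ u) v = drop-length-++ u v

  runs-take-drop : ∀ k c (fs : List (List A × ℕ)) →
    take k (drop c (runs fs)) ≡ runs (take k (drop c fs))
  runs-take-drop k c fs = trans (cong (take k) (drop-map c fs)) (take-map k (drop c fs))

  block-[] : ∀ a n → block {A} [] a n ≡ []
  block-[] a n rewrite drop-[] {A = List A} a = cong concat (take-[] n)

  occursAt-prefix : ∀ {w s : List A} {k} → OccursAt w s k →
    w ++ drop (length w) (drop k s) ≡ drop k s
  occursAt-prefix {w} {s} {k} (_ , eq) =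
    trans (cong (_++ drop (length w) (drop k s)) (sym eq)) (take++drop≡id (length w) (drop k s))

  occursAt-same-start : ∀ {u w s : List A} {k} → OccursAt u s k → OccursAt w s k →
    u ++ drop (length u) (drop k s) ≡ w ++ drop (length w) (drop k s)
  occursAt-same-start occ-u occ-w = trans (occursAt-prefix occ-u) (sym (occursAt-prefix occ-w))

  leftmostOcc-unique : ∀ {w s : List A} {k k′} →
    LeftmostOcc w s k → LeftmostOcc w s k′ → k ≡ k′
  leftmostOcc-unique {k = k} {k′} (occ , first) (occ′ , first′) with <-cmp k k′
  ... | tri< k<k′ _ _ = ⊥-elim (first′ k k<k′ occ)
  ... | tri≈ _ k≡k′ _ = k≡k′
  ... | tri> _ _ k′<k = ⊥-elim (first k′ k′<k occ′)

  suffixInterval : ℕ → List A → List A → Interval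
  suffixInterval S u w = S + length u , S + length w

  suffixInterval-unique : ∀ {u w s : List A} {L S} {I : Interval} →
    LeftmostOcc w s L → LeftmostOcc w s S →
    proj₁ I ≡ L + length u → proj₂ I ≡ L + length w → I ≡ suffixInterval S u w
  suffixInterval-unique {u} {w} {L = L} {S} lo lo′ e₁ e₂ =
    cong₂ _,_ (trans e₁ (cong (_+ length u) L≡S)) (trans e₂ (cong (_+ length w) L≡S))
    where
    L≡S : L ≡ S
    L≡S = leftmostOcc-unique lo lo′

  tandemSub-unique : ∀ {s : List A} {F a k S I} → LeftmostOcc (block F a (suc k)) s S →
    TandemSub s F a k I → I ≡ suffixInterval S (block F (a + 1) k) (block F a (suc k))
  tandemSub-unique {F = F} {a} {k} lo (_ , _ , lo′ , _ , e₁ , e₂) =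
    suffixInterval-unique {u = block F (a + 1) k} lo′ lo e₁ e₂

  pgroupSub-unique : ∀ {s : List A} {F i d q S I} → LeftmostOcc (block F i (suc (q + d))) s S →
    PGroupSub s F i d (suc (suc q)) I →
    I ≡ suffixInterval S (block F (i + suc q) d) (block F i (suc (q + d)))
  pgroupSub-unique {F = F} {i} {d} {q} lo (_ , _ , lo′ , _ , e₁ , e₂) =
    suffixInterval-unique {u = block F (i + suc q) d} lo′ lo e₁ e₂

RevConcat-telescope : ∀ (G : ℕ → ℕ) (α : ℕ → Interval) n →
  (∀ t → t < n → α t ≡ (G (suc t) , G t)) → RevConcat (G n , G 0) α n
RevConcat-telescope G α zero _ = refl
RevConcat-telescope G α (suc n) α≡ rewrite α≡ 0 (s≤s z≤n) =
  refl , RevConcat-telescope (G ∘ suc) (α ∘ suc) n (λ t t<n → α≡ (suc t) (s≤s t<n))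

module Lyndon {A : Set} {_<ₐ_ : A → A → Set} (<ₐ-sto : IsStrictTotalOrder _≡_ _<ₐ_) where

  infix 4 _≺_ _≼_

  _≺_ : List A → List A → Set
  _≺_ = Lex-< _≡_ _<ₐ_

  _≼_ : List A → List A → Set
  u ≼ w = u ≡ w ⊎ u ≺ w

  private
    module Lex = IsStrictPartialOrder
      (<-isStrictPartialOrder (IsStrictTotalOrder.isStrictPartialOrder <ₐ-sto))

  ≺-trans : ∀ {u v w} → u ≺ v → v ≺ w → u ≺ w
  ≺-trans = Lex.trans

  ≺-irrefl : ∀ {u} → ¬ u ≺ u
  ≺-irrefl = Lex.irrefl (≡⇒Pointwise-≡ refl)

  ≼-≺-trans : ∀ {u v w} → u ≼ v → v ≺ w → u ≺ w
  ≼-≺-trans (inj₁ refl) v≺w = v≺w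
  ≼-≺-trans (inj₂ u≺v) v≺w = ≺-trans u≺v v≺w

  ≺⇒⋡ : ∀ {u v} → u ≺ v → ¬ v ≼ u
  ≺⇒⋡ u≺v (inj₁ refl) = ≺-irrefl u≺v
  ≺⇒⋡ u≺v (inj₂ v≺u) = ≺-irrefl (≺-trans u≺v v≺u)

  ≼-++ : ∀ u m → u ≼ u ++ m
  ≼-++ u [] = inj₁ (sym (++-identityʳ u))
  ≼-++ [] (y ∷ m) = inj₂ halt
  ≼-++ (x ∷ u) (y ∷ m) = ⊎-map (cong (x ∷_)) (next refl) (≼-++ u (y ∷ m))

  Lyndon-nonempty : ∀ {f} → IsLyndon _<ₐ_ f → f ≢ []
  Lyndon-nonempty (() , _) refl

  Lyndon-≼-suffix : ∀ v u → IsLyndon _<ₐ_ (v ++ u) → u ≢ [] → v ++ u ≼ u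
  Lyndon-≼-suffix [] u _ _ = inj₁ refl
  Lyndon-≼-suffix (x ∷ v) [] _ u≢[] = ⊥-elim (u≢[] refl)
  Lyndon-≼-suffix (x ∷ v) (y ∷ u) (_ , ≺-suffixes) _ =
    inj₂ (subst (x ∷ v ++ y ∷ u ≺_) (drop-length-++ (x ∷ v) (y ∷ u))
           (≺-suffixes (length (x ∷ v)) (s≤s z≤n) |xv|<|xvyu|))
    where
    |xv|<|xvyu| : length (x ∷ v) < length (x ∷ v ++ y ∷ u)
    |xv|<|xvyu| =
      subst (length (x ∷ v) <_) (sym (length-++ (x ∷ v))) (m<m+n (length (x ∷ v)) (s≤s z≤n))

  Lyndon-suffix-not-prefix : ∀ {f ws} → IsLyndon _<ₐ_ f → All (_≺ f) ws →
    ∀ v u r → v ++ u ≡ f → u ≢ [] → u ++ r ≢ concat ws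
  Lyndon-suffix-not-prefix _ [] v u r _ u≢[] eq = u≢[] (++-conicalˡ u r eq)
  Lyndon-suffix-not-prefix {ws = w ∷ _} f-Lyndon (w≺f ∷ ws≺f) v u r refl u≢[] eq
    with ++-prefix-cases u r w _ eq
  ... | inj₁ (m , w≡um) =
    ≺⇒⋡ (≼-≺-trans (subst (u ≼_) (sym w≡um) (≼-++ u m)) w≺f)
        (Lyndon-≼-suffix v u f-Lyndon u≢[])
  ... | inj₂ (y , m , u≡wym , rest) =
    Lyndon-suffix-not-prefix f-Lyndon ws≺f (v ++ w) (y ∷ m) r
      (trans (++-assoc v w (y ∷ m)) (cong (v ++_) (sym u≡wym))) (λ ()) rest

  concat-runs-≺ : ∀ {f gs} → All (λ ge → proj₁ ge ≺ f) gs →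
    ∃ λ ws → All (_≺ f) ws × concat ws ≡ concat (runs gs)
  concat-runs-≺ [] = [] , [] , refl
  concat-runs-≺ {gs = (h , e) ∷ _} (h≺f ∷ gs≺f) with concat-runs-≺ gs≺f
  ... | ws , ws≺f , eq =
    replicate e h ++ ws , ++⁺ (replicate⁺ e h≺f) ws≺f ,
    trans (sym (concat-++ (replicate e h) ws)) (cong (concat (replicate e h) ++_) eq)

  block-factors-≺ : ∀ {f gs} → All (λ ge → proj₁ ge ≺ f) gs → ∀ c k →
    ∃ λ ws → All (_≺ f) ws × concat ws ≡ block (runs gs) c k
  block-factors-≺ {gs = gs} gs≺f c k with concat-runs-≺ (take⁺ k (drop⁺ c gs≺f))
  ... | ws , ws≺f , eq = ws , ws≺f , trans eq (cong concat (sym (runs-take-drop k c gs)))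

  prefix-of-pow : ∀ {f e ws r₁ r₂} → IsLyndon _<ₐ_ f → 1 ≤ e → All (_≺ f) ws →
    concat ws ++ r₁ ≡ pow _<ₐ_ f e ++ r₂ → ∃ λ x → pow _<ₐ_ f e ≡ concat ws ++ x
  prefix-of-pow {f} {suc e} {ws} f-Lyndon _ ws≺f eq
    with ++-prefix-cases (concat ws) _ (pow _<ₐ_ f (suc e)) _ eq
  ... | inj₁ (x , pow≡) = x , pow≡
  ... | inj₂ (y , m , ws≡ , _) =
    ⊥-elim (Lyndon-suffix-not-prefix f-Lyndon ws≺f [] f (pow _<ₐ_ f e ++ y ∷ m) refl
             (Lyndon-nonempty f-Lyndon) (sym (trans ws≡ (++-assoc f (pow _<ₐ_ f e) (y ∷ m)))))

  LyndonRuns : List (List A × ℕ) → Set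
  LyndonRuns = All (λ fe → IsLyndon _<ₐ_ (proj₁ fe) × (1 ≤ proj₂ fe))

  Decreasing : List (List A × ℕ) → Set
  Decreasing = AllPairs (λ fe ge → proj₁ ge ≺ proj₁ fe)

  Linked⇒Decreasing : ∀ {fs} → Linked (λ fe ge → proj₁ ge ≺ proj₁ fe) fs → Decreasing fs
  Linked⇒Decreasing = Linked⇒AllPairs (λ f₁≻f₂ f₂≻f₃ → ≺-trans f₂≻f₃ f₁≻f₂)

  later-block-prefix : ∀ {fs} → LyndonRuns fs → Decreasing fs → ∀ a c k n {r₁ r₂} →
    block (runs fs) (a + suc c) k ++ r₁ ≡ block (runs fs) a (suc n) ++ r₂ →
    ∃ λ x → block (runs fs) a (suc n) ≡ block (runs fs) (a + suc c) k ++ x ++ block (runs fs) (a + 1) n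
  later-block-prefix {[]} _ _ a c k n _ =
    [] , trans (block-[] a (suc n))
               (sym (cong₂ (λ u w → u ++ [] ++ w) (block-[] (a + suc c) k) (block-[] (a + 1) n)))
  later-block-prefix {(f , e) ∷ fs} ((f-Lyndon , 1≤e) ∷ _) (fs≺f ∷ _) zero c k n {r₁} {r₂} eq
    with block-factors-≺ fs≺f c k
  ... | ws , ws≺f , ws≡U
    with prefix-of-pow f-Lyndon 1≤e ws≺f
           (trans (cong (_++ r₁) ws≡U) (trans eq (++-assoc (pow _<ₐ_ f e) (block (runs fs) 0 n) r₂)))
  ... | x , pow≡ = x , (begin
      pow _<ₐ_ f e ++ B      ≡⟨ cong (_++ B) pow≡ ⟩
      (concat ws ++ x) ++ B  ≡⟨ ++-assoc (concat ws) x B ⟩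
      concat ws ++ x ++ B    ≡⟨ cong (_++ x ++ B) ws≡U ⟩
      block (runs fs) c k ++ x ++ B ∎)
    where
    open ≡-Reasoning
    B : List A
    B = block (runs fs) 0 n
  later-block-prefix {_ ∷ _} (_ ∷ lyndon) (_ ∷ decreasing) (suc a) c k n eq =
    later-block-prefix lyndon decreasing a c k n eq

  later-block-prefix-at : ∀ {s fs} → IsLyndonFactorization _<ₐ_ fs s → ∀ a c k n {S} →
    OccursAt (block (runs fs) (a + suc c) k) s S → OccursAt (block (runs fs) a (suc n)) s S →
    ∃ λ x → block (runs fs) a (suc n) ≡ block (runs fs) (a + suc c) k ++ x ++ block (runs fs) (a + 1) n
  later-block-prefix-at (lyndon , linked , _) a c k n occ-later occ-block =
    later-block-prefix lyndon (Linked⇒Decreasing linked) a c k n (occursAt-same-start occ-later occ-block)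

  tandemSub-at : ∀ {s fs} → IsLyndonFactorization _<ₐ_ fs s → ∀ {a k S} →
    LeftmostOcc (block (runs fs) a (suc k)) s S → OccursAt (block (runs fs) (a + 1) k) s S →
    TandemSub s (runs fs) a k (suffixInterval S (block (runs fs) (a + 1) k) (block (runs fs) a (suc k)))
  tandemSub-at fact {a} {k} {S} lo occ with later-block-prefix-at fact a 0 k k occ (proj₁ lo)
  ... | x , eq = S , x , lo , eq , refl , refl

  pgroupSub-at : ∀ {s fs} → IsLyndonFactorization _<ₐ_ fs s → ∀ {i d q S} →
    LeftmostOcc (block (runs fs) i (suc (q + d))) s S → OccursAt (block (runs fs) (i + suc q) d) s S →
    PGroupSub s (runs fs) i d (suc (suc q))
      (suffixInterval S (block (runs fs) (i + suc q) d) (block (runs fs) i (suc (q + d))))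
  pgroupSub-at fact {i} {d} {q} {S} lo occ with later-block-prefix-at fact i q d (q + d) occ (proj₁ lo)
  ... | x , eq = S , x , lo , eq , refl , refl

-- With p = q + 2, extBlock t is the block Bₜ = F_{i+t} ⋯ F_{i+p+d-2}.
module PGroupBlocks {A : Set} (F : List (List A)) (i d q : ℕ) where

  extBlock : ℕ → List A
  extBlock t = block F (i + t) (d + (suc q ∸ t))

  first-block : block F i (suc (q + d)) ≡ extBlock 0
  first-block = cong₂ (block F) (sym (+-identityʳ i)) (trans (cong suc (+-comm q d)) (sym (+-suc d q)))

  last-block : block F (i + suc q) d ≡ extBlock (suc q)
  last-block = cong (block F (i + suc q)) (sym (trans (cong (d +_) (n∸n≡0 q)) (+-identityʳ d)))

  tandem-block : ∀ t → t ≤ q → block F (i + t) (suc (d + (q ∸ t))) ≡ extBlock t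
  tandem-block t t≤q =
    cong (block F (i + t)) (sym (trans (cong (d +_) (+-∸-assoc 1 t≤q)) (+-suc d (q ∸ t))))

  tandem-tail : ∀ t → block F (i + t + 1) (d + (q ∸ t)) ≡ extBlock (suc t)
  tandem-tail t = cong (λ a → block F a (d + (q ∸ t))) (trans (+-assoc i t 1) (cong (i +_) (+-comm t 1)))

lemma9 : {A : Set} (_<ₐ_ : A → A → Set) → IsStrictTotalOrder _≡_ _<ₐ_ →
    (s : List A) (fs : List (List A × ℕ)) → IsLyndonFactorization _<ₐ_ fs s →
    (i d p : ℕ) → 1 ≤ d → 2 ≤ p → i + d + p ≤ suc (length fs) →
    PGroup s (runs fs) i d p →
    (Σ Interval λ I → (PGroupSub s (runs fs) i d p I
    × Σ (ℕ → Interval) λ α → (∀ t → suc t < p → TandemSub s (runs fs) (i + t) (d + (p ∸ 2 ∸ t)) (α t))))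
    × (∀ (I : Interval) (α : ℕ → Interval) → PGroupSub s (runs fs) i d p I
    → (∀ t → suc t < p → TandemSub s (runs fs) (i + t) (d + (p ∸ 2 ∸ t)) (α t))
    → RevConcat I α (p ∸ 1))
lemma9 _ _ _ _ _ _ _ zero _ () _ _
lemma9 _ _ _ _ _ _ _ (suc zero) _ (s≤s ()) _ _
lemma9 {A} _<ₐ_ sto s fs fact i d (suc (suc q)) _ _ _ (I₀ , extdoms) =
  ( (pgroupInterval , pgroupSub , tandemInterval , tandemSub)
  , λ I α pgroupSub′ tandemSubs →
      subst (λ J → RevConcat J α (suc q)) (sym (pgroupInterval-unique pgroupSub′))
        (RevConcat-telescope (λ t → S + length (extBlock t)) α (suc q) λ t t<q+1 →
          tandemInterval-unique t (≤-pred t<q+1) (tandemSubs t (s≤s t<q+1))))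
  where
  open Lyndon sto using (tandemSub-at; pgroupSub-at)
  F : List (List A)
  F = runs fs
  open PGroupBlocks F i d q
  S : ℕ
  S = proj₁ I₀

  at-S : ∀ {w} t → t < suc (suc q) → w ≡ extBlock t → LeftmostOcc w s S
  at-S t t<p refl with extdoms t t<p
  ... | _ , _ , leftmost , S≡start , _ = subst (LeftmostOcc (extBlock t) s) (sym S≡start) leftmost

  leftmost-first : LeftmostOcc (block F i (suc (q + d))) s S
  leftmost-first = at-S 0 (s≤s z≤n) first-block

  leftmost-tandem : ∀ t → t ≤ q → LeftmostOcc (block F (i + t) (suc (d + (q ∸ t)))) s S
  leftmost-tandem t t≤q = at-S t (s≤s (m≤n⇒m≤1+n t≤q)) (tandem-block t t≤q)

  pgroupInterval : Interval
  pgroupInterval = suffixInterval S (block F (i + suc q) d) (block F i (suc (q + d)))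

  tandemInterval : ℕ → Interval
  tandemInterval t =
    suffixInterval S (block F (i + t + 1) (d + (q ∸ t))) (block F (i + t) (suc (d + (q ∸ t))))

  pgroupSub : PGroupSub s F i d (suc (suc q)) pgroupInterval
  pgroupSub = pgroupSub-at fact {i} {d} {q} leftmost-first
                (proj₁ (at-S (suc q) (n<1+n (suc q)) last-block))

  tandemSub : ∀ t → suc t < suc (suc q) → TandemSub s F (i + t) (d + (q ∸ t)) (tandemInterval t)
  tandemSub t t+1<p =
    tandemSub-at fact {i + t} {d + (q ∸ t)} (leftmost-tandem t (≤-pred (≤-pred t+1<p)))
      (proj₁ (at-S (suc t) t+1<p (tandem-tail t)))

  pgroupInterval-unique : ∀ {I} → PGroupSub s F i d (suc (suc q)) I →
    I ≡ suffixInterval S (extBlock (suc q)) (extBlock 0)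
  pgroupInterval-unique pgroupSub′ =
    trans (pgroupSub-unique {F = F} {i} {d} {q} leftmost-first pgroupSub′)
          (cong₂ (suffixInterval S) last-block first-block)

  tandemInterval-unique : ∀ t → t ≤ q → ∀ {I} → TandemSub s F (i + t) (d + (q ∸ t)) I →
    I ≡ suffixInterval S (extBlock (suc t)) (extBlock t)
  tandemInterval-unique t t≤q tandemSub′ =
    trans (tandemSub-unique {F = F} {i + t} {d + (q ∸ t)} (leftmost-tandem t t≤q) tandemSub′)
          (cong₂ (suffixInterval S) (tandem-tail t) (tandem-block t t≤q))
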